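{- Let $G=(A,B,E)$ be a bipartite graph whose edges arrive as a stream in an arbitrary (adversarial) order, the same order in every pass. Consider the following three-pass semi-streaming algorithm. (1) In the first pass, compute a maximal matching $M_0$ of $G$ (e.g. greedily). (2) In the second pass, compute (greedily) a maximal matching $M_A$ in the edge set $F_2 := \{ab \in E : a \in A(M_0),\ b \in B\setminus B(M_0)\}$. (3) In the third pass, compute (greedily) a maximal matching $M_B$ in $F_3 := \{ab \in E : a \in A\setminus A(M_0) \text{ and there is } a' \in A(M_A) \text{ with } a'b \in M_0\}$. (4) Augment $M_0$ using $M_A$ and $M_B$: for every $ab \in M_B$, let $a'$ be the $M_0$-partner of $b$ and $b'$ the $M_A$-partner of $a'$, and replace $a'b$ by $ab$ and $a'b'$. Output the resulting matching $M$. Then $|M| \ge (1/2 + 1/10)\,|M^*|$, where $M^*$ is a maximum matching of $G$.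
   Context: For a set of edges $F$ and a set of vertices $U$, $U(F)$ denotes the set of vertices of $U$ incident to at least one edge of $F$. A semi-streaming algorithm reads the edge stream sequentially (possibly in several passes) and uses $O(n\,\mathrm{polylog}\, n)$ space, where $n$ is the number of vertices. -}

module Defs where

open import Data.Nat using (ℕ)
open import Data.Fin using (Fin; _≟_)
open import Data.Bool using (true; false)
open import Data.Maybe using (Maybe; just; nothing)
open import Data.Product using (_×_; _,_; proj₁; proj₂)
open import Data.List using (List; []; _∷_; _++_; filter; length)
open import Data.List.Membership.Propositional using (_∈_)
open import Data.List.Relation.Unary.All using (All)
open import Data.List.Relation.Unary.Any using (Any; any?)
open import Data.List.Relation.Unary.AllPairs using (AllPairs)
open import Relation.Nullary using (¬_; Dec; yes; no)
open import Relation.Nullary.Decidable using (_×-dec_; ¬?)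
open import Relation.Binary.PropositionalEquality using (_≡_; _≢_)

-- Bipartite graph with sides A = Fin m and B = Fin n; an edge ab is a pair (a , b).
Edge : ℕ → ℕ → Set
Edge m n = Fin m × Fin n

module _ {m n : ℕ} where

  Disjoint : Edge m n → Edge m n → Set
  Disjoint e f = (proj₁ e ≢ proj₁ f) × (proj₂ e ≢ proj₂ f)

  Adjacent : Edge m n → Edge m n → Set
  Adjacent e f = (proj₁ e ≡ proj₁ f) ⊎' (proj₂ e ≡ proj₂ f)
    where
    open import Data.Sum using () renaming (_⊎_ to _⊎'_)

  -- a matching is a list of pairwise vertex-disjoint edges (in particular no duplicates,
  -- so its length is its size)
  IsMatching : List (Edge m n) → Set
  IsMatching M = AllPairs Disjoint M

  MatchingIn : (Edge m n → Set) → List (Edge m n) → Set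
  MatchingIn S M = IsMatching M × All S M

  MaximalMatchingIn : (Edge m n → Set) → List (Edge m n) → Set
  MaximalMatchingIn S M =
    MatchingIn S M × (∀ e → S e → Any (Adjacent e) M)

  MaximumMatchingIn : (Edge m n → Set) → List (Edge m n) → Set
  MaximumMatchingIn S M =
    MatchingIn S M × (∀ M' → MatchingIn S M' → length M' ≤ℕ length M)
    where
    open import Data.Nat using () renaming (_≤_ to _≤ℕ_)

  _∈A_ : Fin m → List (Edge m n) → Set
  a ∈A M = Any (λ e → proj₁ e ≡ a) M

  _∈B_ : Fin n → List (Edge m n) → Set
  b ∈B M = Any (λ e → proj₂ e ≡ b) M

  _∈A?_ : (a : Fin m) (M : List (Edge m n)) → Dec (a ∈A M)
  a ∈A? M = any? (λ e → proj₁ e ≟ a) M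

  _∈B?_ : (b : Fin n) (M : List (Edge m n)) → Dec (b ∈B M)
  b ∈B? M = any? (λ e → proj₂ e ≟ b) M

  greedyFrom : List (Edge m n) → List (Edge m n) → List (Edge m n)
  greedyFrom acc [] = acc
  greedyFrom acc (e ∷ es) with proj₁ e ∈A? acc | proj₂ e ∈B? acc
  ... | no _ | no _ = greedyFrom (e ∷ acc) es
  ... | _    | _    = greedyFrom acc es

  greedy : List (Edge m n) → List (Edge m n)
  greedy = greedyFrom []

  InF₂ : List (Edge m n) → Edge m n → Set
  InF₂ M₀ e = (proj₁ e ∈A M₀) × ¬ (proj₂ e ∈B M₀)

  InF₂? : (M₀ : List (Edge m n)) (e : Edge m n) → Dec (InF₂ M₀ e)
  InF₂? M₀ e = (proj₁ e ∈A? M₀) ×-dec ¬? (proj₂ e ∈B? M₀)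

  InF₃ : List (Edge m n) → List (Edge m n) → Edge m n → Set
  InF₃ M₀ MA e = ¬ (proj₁ e ∈A M₀)
               × Any (λ f → (proj₂ f ≡ proj₂ e) × (proj₁ f ∈A MA)) M₀

  InF₃? : (M₀ MA : List (Edge m n)) (e : Edge m n) → Dec (InF₃ M₀ MA e)
  InF₃? M₀ MA e = ¬? (proj₁ e ∈A? M₀)
                ×-dec any? (λ f → (proj₂ f ≟ proj₂ e) ×-dec (proj₁ f ∈A? MA)) M₀

  partnerOfB : List (Edge m n) → Fin n → Maybe (Fin m)
  partnerOfB [] b = nothing
  partnerOfB (f ∷ M) b with proj₂ f ≟ b
  ... | yes _ = just (proj₁ f)
  ... | no _  = partnerOfB M b

  partnerOfA : List (Edge m n) → Fin m → Maybe (Fin n)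
  partnerOfA [] a = nothing
  partnerOfA (f ∷ M) a with proj₁ f ≟ a
  ... | yes _ = just (proj₂ f)
  ... | no _  = partnerOfA M a

  newEdges : List (Edge m n) → List (Edge m n) → List (Edge m n) → List (Edge m n)
  newEdges M₀ MA [] = []
  newEdges M₀ MA ((a , b) ∷ MB) with partnerOfB M₀ b
  ... | nothing = newEdges M₀ MA MB
  ... | just a' with partnerOfA MA a'
  ...   | nothing = newEdges M₀ MA MB
  ...   | just b' = (a' , b') ∷ newEdges M₀ MA MB

  -- augmentation: remove a'b (the M₀-edges whose B-endpoint is matched by M_B),
  -- add every ab ∈ M_B and every a'b'
  augment : List (Edge m n) → List (Edge m n) → List (Edge m n) → List (Edge m n)
  augment M₀ MA MB =
    filter (λ f → ¬? (proj₂ f ∈B? MB)) M₀ ++ MB ++ newEdges M₀ MA MB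

  -- passes 2 and 3 (greedy over the stream, same order) followed by the augmentation,
  -- given the first-pass maximal matching M₀
  passA : List (Edge m n) → List (Edge m n) → List (Edge m n)
  passA stream M₀ = greedy (filter (InF₂? M₀) stream)

  passB : List (Edge m n) → List (Edge m n) → List (Edge m n)
  passB stream M₀ = greedy (filter (InF₃? M₀ (passA stream M₀)) stream)

  output : List (Edge m n) → List (Edge m n) → List (Edge m n)
  output stream M₀ = augment M₀ (passA stream M₀) (passB stream M₀)

{-# OPTIONS --safe #-}
-- Split the edges of M⋆ by whether their A-endpoint lies in A(M₀). Those that do are
-- x edges of F₂ and z edges with both endpoints in V(M₀); those that do not have their
-- B-endpoint in B(M₀) by maximality of M₀, and are y₁ edges of F₃ and y₂ others.
-- Counting the distinct endpoints of these edges in M₀ gives x + z ≤ |M₀| and z + y₁ + y₂ ≤ |M₀|;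
-- maximality of M_A in F₂ and of M_B in F₃ gives x ≤ 2|M_A| and y₁ ≤ 2|M_B|; an M_A-edge and a
-- y₂-edge never reach the same M₀-edge, so |M_A| + y₂ ≤ |M₀|; and the augmentation yields
-- |M| ≥ |M₀| + |M_B|. Adding these with weights 4, 2, 2, 4, 4 cancels |M_A| and leaves 6|M⋆| ≤ 10|M|.
module Submission where

open import Defs
open import Data.Nat using (ℕ; suc; _+_; _*_; _≤_; z≤n; s≤s)
open import Data.Nat.Properties
  using (+-suc; +-comm; +-assoc; +-identityʳ; +-mono-≤; +-monoˡ-≤; +-monoʳ-≤; *-monoʳ-≤; *-monoˡ-≤; *-distribˡ-+; m≤m+n; +-cancelʳ-≤; ≤-reflexive; module ≤-Reasoning)
open import Data.Nat.Solver using (module +-*-Solver)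
open import Data.Fin using (_≟_)
open import Data.Maybe using (just)
open import Data.Product using (_×_; _,_; proj₁; proj₂; ∃)
open import Data.Sum using (_⊎_; inj₁; inj₂; [_,_]′)
open import Data.Empty using (⊥; ⊥-elim)
open import Data.List using (List; []; _∷_; filter; length)
open import Data.List.Properties using (length-++; length-removeAt′)
open import Data.List.Membership.Propositional using (_∈_; find; lose)
open import Data.List.Membership.Propositional.Properties using (∈-filter⁺; ∈-filter⁻)
open import Data.List.Relation.Unary.All as All using (All; []; _∷_)
open import Data.List.Relation.Unary.All.Properties as All using (all-filter; ¬Any⇒All¬)
open import Data.List.Relation.Unary.Any as Any using (Any; here; there)
open import Data.List.Relation.Unary.Any.Properties using (Any-⊎⁻)
open import Data.List.Relation.Unary.AllPairs as AllPairs using (AllPairs; []; _∷_)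
import Data.List.Relation.Unary.AllPairs.Properties as AllPairs
open import Function using (_∘_; _⇔_; mk⇔; Equivalence)
open import Relation.Nullary using (¬_; yes; no; contradiction)
open import Relation.Nullary.Decidable using (toSum; _×-dec_)
open import Relation.Unary using (Decidable)
open import Relation.Unary.Properties using (∁?; _∩?_)
open import Relation.Binary.PropositionalEquality using (_≡_; _≢_; refl; sym; trans; cong; cong₂; subst; module ≡-Reasoning)

module _ {X : Set} {P : X → Set} (P? : Decidable P) where

  length-filter-∁ : ∀ xs → length (filter P? xs) + length (filter (∁? P?) xs) ≡ length xs
  length-filter-∁ [] = refl
  length-filter-∁ (x ∷ xs) with P? x
  ... | yes _ = cong suc (length-filter-∁ xs)
  ... | no _  = trans (+-suc _ _) (cong suc (length-filter-∁ xs))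

module _ {X : Set} {R A B : X → Set} (R? : Decidable R) (A? : Decidable A) (B? : Decidable B) where

  length-filter-⊎ : ∀ {xs} → All (λ x → R x ⇔ (A x ⊎ B x)) xs → All (λ x → ¬ (A x × B x)) xs
                  → length (filter R? xs) ≡ length (filter A? xs) + length (filter B? xs)
  length-filter-⊎ [] [] = refl
  length-filter-⊎ {x ∷ xs} (R⇔A⊎B ∷ R⇔A⊎Bs) (A∩B=∅ ∷ A∩B=∅s)
    with ih ← length-filter-⊎ R⇔A⊎Bs A∩B=∅s | A? x | B? x | R? x
  ... | yes a | yes b | _     = ⊥-elim (A∩B=∅ (a , b))
  ... | yes _ | no _  | yes _ = cong suc ih
  ... | no _  | yes _ | yes _ = trans (cong suc ih) (sym (+-suc _ _))
  ... | no _  | no _  | no _  = ih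
  ... | yes a | no _  | no ¬r = contradiction (Equivalence.from R⇔A⊎B (inj₁ a)) ¬r
  ... | no _  | yes b | no ¬r = contradiction (Equivalence.from R⇔A⊎B (inj₂ b)) ¬r
  ... | no ¬a | no ¬b | yes r = ⊥-elim ([ ¬a , ¬b ]′ (Equivalence.to R⇔A⊎B r))

length-filter-∩∁ : ∀ {X : Set} {P Q : X → Set} (P? : Decidable P) (Q? : Decidable Q) xs
                 → length (filter P? xs) ≡ length (filter (P? ∩? ∁? Q?) xs) + length (filter (P? ∩? Q?) xs)
length-filter-∩∁ {P = P} {Q} P? Q? xs =
  length-filter-⊎ P? (P? ∩? ∁? Q?) (P? ∩? Q?) (All.universal split xs) (All.universal disjoint xs)
  where
  split : ∀ x → P x ⇔ ((P x × ¬ Q x) ⊎ (P x × Q x))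
  split x = mk⇔ (λ p → [ (λ q → inj₂ (p , q)) , (λ ¬q → inj₁ (p , ¬q)) ]′ (toSum (Q? x))) [ proj₁ , proj₁ ]′
  disjoint : ∀ x → ¬ ((P x × ¬ Q x) × (P x × Q x))
  disjoint x ((_ , ¬q) , (_ , q)) = ¬q q

module _ {Y : Set} {P Q : Y → Set} where

  Any-─⁺ : ∀ {ys} (p : Any P ys) → (∀ {y} → P y → Q y → ⊥) → Any Q ys → Any Q (ys Any.─ p)
  Any-─⁺ (here py) P∩Q=∅ (here qy) = ⊥-elim (P∩Q=∅ py qy)
  Any-─⁺ (here _)  _     (there q) = q
  Any-─⁺ (there _) _     (here qy) = here qy
  Any-─⁺ (there p) P∩Q=∅ (there q) = there (Any-─⁺ p P∩Q=∅ q)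

module _ {X Y K : Set} (key : X → K) (key′ : Y → K) where

  length-≤-by-keys : ∀ {xs ys} → AllPairs (λ x x′ → key x ≢ key x′) xs
                   → All (λ x → Any (λ y → key′ y ≡ key x) ys) xs → length xs ≤ length ys
  length-≤-by-keys {[]} [] [] = z≤n
  length-≤-by-keys {x ∷ xs} {ys} (x-fresh ∷ xs-distinct) (p ∷ ps) = begin
    suc (length xs)           ≤⟨ s≤s (length-≤-by-keys xs-distinct (All.zipWith witness′ (x-fresh , ps))) ⟩
    suc (length (ys Any.─ p)) ≡⟨ sym (length-removeAt′ ys (Any.index p)) ⟩
    length ys                 ∎
    where
    open ≤-Reasoning
    witness′ : ∀ {x′} → key x ≢ key x′ × Any (λ y → key′ y ≡ key x′) ys
             → Any (λ y → key′ y ≡ key x′) (ys Any.─ p)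
    witness′ (x≢x′ , q) = Any-─⁺ p (λ e e′ → x≢x′ (trans (sym e) e′)) q

module _ {m n : ℕ} where

  matching-∈A⇒length≤ : ∀ {L M : List (Edge m n)} → IsMatching L → All (λ e → proj₁ e ∈A M) L
                      → length L ≤ length M
  matching-∈A⇒length≤ L-matching = length-≤-by-keys proj₁ proj₁ (AllPairs.map proj₁ L-matching)

  matching-∈B⇒length≤ : ∀ {L M : List (Edge m n)} → IsMatching L → All (λ e → proj₂ e ∈B M) L
                      → length L ≤ length M
  matching-∈B⇒length≤ L-matching = length-≤-by-keys proj₂ proj₂ (AllPairs.map proj₂ L-matching)

  ∈B-of-Adjacent : ∀ {e : Edge m n} {M} → Any (Adjacent e) M → ¬ (proj₁ e ∈A M) → proj₂ e ∈B M
  ∈B-of-Adjacent adj e∉A with Any-⊎⁻ (Any.map [ inj₁ ∘ sym , inj₂ ∘ sym ]′ adj)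
  ... | inj₁ e∈A = contradiction e∈A e∉A
  ... | inj₂ e∈B = e∈B

  length≤2*-of-covered : ∀ {L M : List (Edge m n)} → IsMatching L → All (λ e → Any (Adjacent e) M) L
                       → length L ≤ 2 * length M
  length≤2*-of-covered {L} {M} L-matching L-covered = begin
    length L                                            ≡⟨ sym (length-filter-∁ A? L) ⟩
    length (filter A? L) + length (filter (∁? A?) L)    ≤⟨ +-mono-≤ via-A via-B ⟩
    length M + length M                                 ≡⟨ cong (length M +_) (sym (+-identityʳ (length M))) ⟩
    2 * length M                                        ∎
    where
    open ≤-Reasoning
    A? : Decidable (λ (e : Edge m n) → proj₁ e ∈A M)
    A? e = proj₁ e ∈A? M
    via-A : length (filter A? L) ≤ length M
    via-A = matching-∈A⇒length≤ (AllPairs.filter⁺ A? L-matching) (all-filter A? L)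
    via-B : length (filter (∁? A?) L) ≤ length M
    via-B = matching-∈B⇒length≤ (AllPairs.filter⁺ (∁? A?) L-matching)
              (All.zipWith (λ (adj , e∉A) → ∈B-of-Adjacent adj e∉A)
                           (All.filter⁺ (∁? A?) L-covered , all-filter (∁? A?) L))

  length≤2*-of-maximal : ∀ {S : Edge m n → Set} {M L} → MaximalMatchingIn S M → MatchingIn S L
                       → length L ≤ 2 * length M
  length≤2*-of-maximal (_ , M-maximal) (L-matching , L⊆S) =
    length≤2*-of-covered L-matching (All.map (M-maximal _) L⊆S)

  MatchingIn-filter : ∀ {S C : Edge m n → Set} (C? : Decidable C) {L} → MatchingIn S L
                    → MatchingIn (λ e → S e × C e) (filter C? L)
  MatchingIn-filter C? {L} (L-matching , L⊆S) =
    AllPairs.filter⁺ C? L-matching , All.zip (All.filter⁺ C? L⊆S , all-filter C? L)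

  fresh-Disjoint : ∀ {e : Edge m n} acc → ¬ (proj₁ e ∈A acc) → ¬ (proj₂ e ∈B acc) → All (Disjoint e) acc
  fresh-Disjoint acc a∉ b∉ =
    All.zipWith (λ (a≢ , b≢) → a≢ ∘ sym , b≢ ∘ sym) (¬Any⇒All¬ acc a∉ , ¬Any⇒All¬ acc b∉)

  greedyFrom-matching : ∀ (acc es : List (Edge m n)) → IsMatching acc → IsMatching (greedyFrom acc es)
  greedyFrom-matching acc [] acc-matching = acc-matching
  greedyFrom-matching acc (e ∷ es) acc-matching with proj₁ e ∈A? acc | proj₂ e ∈B? acc
  ... | no a∉ | no b∉ = greedyFrom-matching (e ∷ acc) es (fresh-Disjoint acc a∉ b∉ ∷ acc-matching)
  ... | yes _ | _     = greedyFrom-matching acc es acc-matching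
  ... | no _  | yes _ = greedyFrom-matching acc es acc-matching

  greedyFrom-All : ∀ {S : Edge m n → Set} acc es → All S acc → All S es → All S (greedyFrom acc es)
  greedyFrom-All acc [] acc⊆S _ = acc⊆S
  greedyFrom-All acc (e ∷ es) acc⊆S (Se ∷ es⊆S) with proj₁ e ∈A? acc | proj₂ e ∈B? acc
  ... | no _  | no _  = greedyFrom-All (e ∷ acc) es (Se ∷ acc⊆S) es⊆S
  ... | yes _ | _     = greedyFrom-All acc es acc⊆S es⊆S
  ... | no _  | yes _ = greedyFrom-All acc es acc⊆S es⊆S

  greedyFrom-keeps-covered : ∀ (e : Edge m n) acc es → Any (Adjacent e) acc → Any (Adjacent e) (greedyFrom acc es)
  greedyFrom-keeps-covered e acc [] covered = covered
  greedyFrom-keeps-covered e acc (f ∷ es) covered with proj₁ f ∈A? acc | proj₂ f ∈B? acc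
  ... | no _  | no _  = greedyFrom-keeps-covered e (f ∷ acc) es (there covered)
  ... | yes _ | _     = greedyFrom-keeps-covered e acc es covered
  ... | no _  | yes _ = greedyFrom-keeps-covered e acc es covered

  greedyFrom-covers : ∀ (e : Edge m n) acc es → e ∈ es → Any (Adjacent e) (greedyFrom acc es)
  greedyFrom-covers e acc (f ∷ es) (there e∈es) with proj₁ f ∈A? acc | proj₂ f ∈B? acc
  ... | no _  | no _  = greedyFrom-covers e (f ∷ acc) es e∈es
  ... | yes _ | _     = greedyFrom-covers e acc es e∈es
  ... | no _  | yes _ = greedyFrom-covers e acc es e∈es
  greedyFrom-covers e acc (e ∷ es) (here refl) with proj₁ e ∈A? acc | proj₂ e ∈B? acc
  ... | no _  | no _  = greedyFrom-keeps-covered e (e ∷ acc) es (here (inj₁ refl))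
  ... | yes a | _     = greedyFrom-keeps-covered e acc es (Any.map (inj₁ ∘ sym) a)
  ... | no _  | yes b = greedyFrom-keeps-covered e acc es (Any.map (inj₂ ∘ sym) b)

  greedy-maximal : ∀ es → MaximalMatchingIn (_∈ es) (greedy es)
  greedy-maximal es =
    (greedyFrom-matching [] es [] , greedyFrom-All [] es [] (All.tabulate (λ e∈es → e∈es))) ,
    λ e e∈es → greedyFrom-covers e [] es e∈es

  greedy-filter-maximal : ∀ {C : Edge m n → Set} (C? : Decidable C) es
                        → MaximalMatchingIn (λ e → e ∈ es × C e) (greedy (filter C? es))
  greedy-filter-maximal C? es with greedy-maximal (filter C? es)
  ... | (M-matching , M⊆es) , M-maximal =
    (M-matching , All.map (∈-filter⁻ C?) M⊆es) , λ e (e∈es , Ce) → M-maximal e (∈-filter⁺ C? e∈es Ce)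

  partnerOfB-∈ : ∀ {M : List (Edge m n)} {f} → IsMatching M → f ∈ M → partnerOfB M (proj₂ f) ≡ just (proj₁ f)
  partnerOfB-∈ {g ∷ M} {f} (g-disjoint ∷ M-matching) f∈ with proj₂ g ≟ proj₂ f | f∈
  ... | yes _  | here refl  = refl
  ... | yes eq | there f∈M  = contradiction eq (proj₂ (All.lookup g-disjoint f∈M))
  ... | no neq | here refl  = contradiction refl neq
  ... | no _   | there f∈M  = partnerOfB-∈ M-matching f∈M

  partnerOfA-∈A : ∀ {M : List (Edge m n)} {a} → a ∈A M → ∃ λ b → partnerOfA M a ≡ just b
  partnerOfA-∈A {g ∷ M} {a} a∈A with proj₁ g ≟ a | a∈A
  ... | yes _  | _         = proj₂ g , refl
  ... | no neq | here eq   = contradiction eq neq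
  ... | no _   | there a∈M = partnerOfA-∈A a∈M

  length-newEdges : ∀ {M₀ MA MB : List (Edge m n)} → IsMatching M₀ → All (InF₃ M₀ MA) MB
                  → length (newEdges M₀ MA MB) ≡ length MB
  length-newEdges _ [] = refl
  length-newEdges {M₀} {MA} {(a , b) ∷ MB} M₀-matching ((_ , partner∈A) ∷ MB⊆F₃)
    with find partner∈A
  ... | f , f∈M₀ , refl , f∈A
    rewrite partnerOfB-∈ M₀-matching f∈M₀ | proj₂ (partnerOfA-∈A f∈A) =
    cong suc (length-newEdges M₀-matching MB⊆F₃)

  length-augment : ∀ {M₀ MA MB : List (Edge m n)} → IsMatching M₀ → All (InF₃ M₀ MA) MB
                 → length M₀ + length MB ≤ length (augment M₀ MA MB)
  length-augment {M₀} {MA} {MB} M₀-matching MB⊆F₃ = begin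
    length M₀ + length MB                              ≡⟨ cong (_+ length MB) (sym (length-filter-∁ R? M₀)) ⟩
    length (filter R? M₀) + length kept + length MB    ≤⟨ +-monoˡ-≤ (length MB) (+-monoˡ-≤ (length kept) removed≤) ⟩
    length MB + length kept + length MB                ≡⟨ cong (_+ length MB) (+-comm (length MB) (length kept)) ⟩
    length kept + length MB + length MB                ≡⟨ +-assoc (length kept) (length MB) (length MB) ⟩
    length kept + (length MB + length MB)              ≡⟨ cong (λ t → length kept + (length MB + t)) (sym new≡) ⟩
    length kept + (length MB + length new)             ≡⟨ sym (trans (length-++ kept) (cong (length kept +_) (length-++ MB))) ⟩
    length (augment M₀ MA MB)                          ∎
    where
    open ≤-Reasoning
    R? : Decidable (λ (f : Edge m n) → proj₂ f ∈B MB)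
    R? f = proj₂ f ∈B? MB
    kept : List (Edge m n)
    kept = filter (∁? R?) M₀
    new : List (Edge m n)
    new = newEdges M₀ MA MB
    new≡ : length new ≡ length MB
    new≡ = length-newEdges M₀-matching MB⊆F₃
    removed≤ : length (filter R? M₀) ≤ length MB
    removed≤ = matching-∈B⇒length≤ (AllPairs.filter⁺ R? M₀-matching) (all-filter R? M₀)

weighted-sum : ∀ {opt x z y₁ y₂ k s b out}
             → opt ≤ x + z + (y₁ + y₂) → x + z ≤ k → z + (y₁ + y₂) ≤ k → x ≤ 2 * s → y₁ ≤ 2 * b → s + y₂ ≤ k
             → k + b ≤ out → 6 * opt ≤ 10 * out
weighted-sum {opt} {x} {z} {y₁} {y₂} {k} {s} {b} {out} h-opt h-A h-B h-x h-y₁ h-y₂ h-out =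
  +-cancelʳ-≤ (4 * s) (6 * opt) (10 * out) (begin
    6 * opt + 4 * s                                                    ≤⟨ +-monoˡ-≤ (4 * s) (*-monoʳ-≤ 6 h-opt) ⟩
    6 * (x + z + (y₁ + y₂)) + 4 * s                                    ≡⟨ regroup-lhs x z y₁ y₂ s ⟩
    4 * (x + z) + 2 * (z + (y₁ + y₂)) + 2 * x + 4 * (s + y₂) + 4 * y₁  ≤⟨ combination ⟩
    4 * k + 2 * k + 2 * (2 * s) + 4 * k + 4 * (2 * b)                  ≡⟨ regroup-rhs k s b ⟩
    10 * k + 8 * b + 4 * s                                             ≤⟨ +-monoˡ-≤ (4 * s) (+-monoʳ-≤ (10 * k) (*-monoˡ-≤ b (m≤m+n 8 2))) ⟩
    10 * k + 10 * b + 4 * s                                            ≡⟨ cong (_+ 4 * s) (sym (*-distribˡ-+ 10 k b)) ⟩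
    10 * (k + b) + 4 * s                                               ≤⟨ +-monoˡ-≤ (4 * s) (*-monoʳ-≤ 10 h-out) ⟩
    10 * out + 4 * s                                                   ∎)
  where
  open ≤-Reasoning
  open +-*-Solver
  regroup-lhs : ∀ x z y₁ y₂ s → 6 * (x + z + (y₁ + y₂)) + 4 * s
              ≡ 4 * (x + z) + 2 * (z + (y₁ + y₂)) + 2 * x + 4 * (s + y₂) + 4 * y₁
  regroup-lhs = solve 5 (λ x z y₁ y₂ s → con 6 :* (x :+ z :+ (y₁ :+ y₂)) :+ con 4 :* s
                  := con 4 :* (x :+ z) :+ con 2 :* (z :+ (y₁ :+ y₂)) :+ con 2 :* x :+ con 4 :* (s :+ y₂) :+ con 4 :* y₁) refl
  regroup-rhs : ∀ k s b → 4 * k + 2 * k + 2 * (2 * s) + 4 * k + 4 * (2 * b) ≡ 10 * k + 8 * b + 4 * s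
  regroup-rhs = solve 3 (λ k s b → con 4 :* k :+ con 2 :* k :+ con 2 :* (con 2 :* s) :+ con 4 :* k :+ con 4 :* (con 2 :* b)
                  := con 10 :* k :+ con 8 :* b :+ con 4 :* s) refl
  combination : 4 * (x + z) + 2 * (z + (y₁ + y₂)) + 2 * x + 4 * (s + y₂) + 4 * y₁
              ≤ 4 * k + 2 * k + 2 * (2 * s) + 4 * k + 4 * (2 * b)
  combination = +-mono-≤ (+-mono-≤ (+-mono-≤ (+-mono-≤ (*-monoʳ-≤ 4 h-A) (*-monoʳ-≤ 2 h-B))
                  (*-monoʳ-≤ 2 h-x)) (*-monoʳ-≤ 4 h-y₂)) (*-monoʳ-≤ 4 h-y₁)

module ThreePassBounds {m n : ℕ} (stream M₀ M⋆ : List (Edge m n))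
  (M₀-maximal : MaximalMatchingIn (_∈ stream) M₀) (M⋆-matching : MatchingIn (_∈ stream) M⋆) where

  MA MB : List (Edge m n)
  MA = passA stream M₀
  MB = passB stream M₀

  MA-maximal : MaximalMatchingIn (λ e → e ∈ stream × InF₂ M₀ e) MA
  MA-maximal = greedy-filter-maximal (InF₂? M₀) stream

  MA⊆F₂ : All (InF₂ M₀) MA
  MA⊆F₂ = All.map proj₂ (proj₂ (proj₁ MA-maximal))

  MB-maximal : MaximalMatchingIn (λ e → e ∈ stream × InF₃ M₀ MA e) MB
  MB-maximal = greedy-filter-maximal (InF₃? M₀ MA) stream

  A₀? : Decidable (λ (e : Edge m n) → proj₁ e ∈A M₀)
  A₀? e = proj₁ e ∈A? M₀

  B₀? : Decidable (λ (e : Edge m n) → proj₂ e ∈B M₀)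
  B₀? e = proj₂ e ∈B? M₀

  PartnerInMA? : Decidable (λ (e : Edge m n) → Any (λ f → (proj₂ f ≡ proj₂ e) × (proj₁ f ∈A MA)) M₀)
  PartnerInMA? e = Any.any? (λ f → (proj₂ f ≟ proj₂ e) ×-dec (proj₁ f ∈A? MA)) M₀

  Y₂? : Decidable (λ (e : Edge m n) → ¬ (proj₁ e ∈A M₀) × ¬ Any (λ f → (proj₂ f ≡ proj₂ e) × (proj₁ f ∈A MA)) M₀)
  Y₂? = ∁? A₀? ∩? ∁? PartnerInMA?

  #_ : {C : Edge m n → Set} → Decidable C → ℕ
  # C? = length (filter C? M⋆)

  x z y₁ y₂ : ℕ
  x  = # InF₂? M₀
  z  = # (A₀? ∩? B₀?)
  y₁ = # InF₃? M₀ MA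
  y₂ = # Y₂?

  ∉A₀⇒∈B₀ : ∀ {e} → e ∈ stream → ¬ (proj₁ e ∈A M₀) → proj₂ e ∈B M₀
  ∉A₀⇒∈B₀ {e} e∈stream = ∈B-of-Adjacent (proj₂ M₀-maximal e e∈stream)

  #∉A₀ : # ∁? A₀? ≡ y₁ + y₂
  #∉A₀ = trans (length-filter-∩∁ (∁? A₀?) PartnerInMA? M⋆) (+-comm y₂ y₁)

  M⋆-bound : length M⋆ ≤ x + z + (y₁ + y₂)
  M⋆-bound = ≤-reflexive (begin
    length M⋆       ≡⟨ sym (length-filter-∁ A₀? M⋆) ⟩
    # A₀? + # ∁? A₀? ≡⟨ cong₂ _+_ (length-filter-∩∁ A₀? B₀? M⋆) #∉A₀ ⟩
    x + z + (y₁ + y₂) ∎)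
    where open ≡-Reasoning

  A₀-bound : x + z ≤ length M₀
  A₀-bound = subst (_≤ length M₀) (length-filter-∩∁ A₀? B₀? M⋆)
    (matching-∈A⇒length≤ (AllPairs.filter⁺ A₀? (proj₁ M⋆-matching)) (all-filter A₀? M⋆))

  B₀-bound : z + (y₁ + y₂) ≤ length M₀
  B₀-bound = subst (_≤ length M₀) (trans #B₀ (cong (z +_) #∉A₀))
    (matching-∈B⇒length≤ (AllPairs.filter⁺ B₀? (proj₁ M⋆-matching)) (all-filter B₀? M⋆))
    where
    split : ∀ {e} → e ∈ stream → proj₂ e ∈B M₀ ⇔ ((proj₁ e ∈A M₀ × proj₂ e ∈B M₀) ⊎ ¬ (proj₁ e ∈A M₀))
    split {e} e∈stream = mk⇔ (λ b∈B → [ (λ a∈A → inj₁ (a∈A , b∈B)) , inj₂ ]′ (toSum (A₀? e)))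
                             [ proj₂ , ∉A₀⇒∈B₀ e∈stream ]′
    #B₀ : # B₀? ≡ z + # ∁? A₀?
    #B₀ = length-filter-⊎ B₀? (A₀? ∩? B₀?) (∁? A₀?) (All.map split (proj₂ M⋆-matching))
            (All.universal (λ _ ((a∈A , _) , a∉A) → a∉A a∈A) M⋆)

  x-bound : x ≤ 2 * length MA
  x-bound = length≤2*-of-maximal MA-maximal (MatchingIn-filter (InF₂? M₀) M⋆-matching)

  y₁-bound : y₁ ≤ 2 * length MB
  y₁-bound = length≤2*-of-maximal MB-maximal (MatchingIn-filter (InF₃? M₀ MA) M⋆-matching)

  -- An M_A-edge is charged to the M₀-edge at its A-endpoint, a y₂-edge to the M₀-edge at its
  -- B-endpoint; the first kind of M₀-edge has its A-endpoint in A(M_A), the second does not.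
  y₂-bound : length MA + y₂ ≤ length M₀
  y₂-bound = begin
    length MA + y₂                                           ≤⟨ +-mono-≤ MA≤ y₂≤ ⟩
    length (filter InMA? M₀) + length (filter (∁? InMA?) M₀) ≡⟨ length-filter-∁ InMA? M₀ ⟩
    length M₀                                                ∎
    where
    open ≤-Reasoning
    InMA? : Decidable (λ (f : Edge m n) → proj₁ f ∈A MA)
    InMA? f = proj₁ f ∈A? MA
    MA-partner : ∀ {g} → g ∈ MA → proj₁ g ∈A filter InMA? M₀
    MA-partner g∈MA with find (proj₁ (All.lookup MA⊆F₂ g∈MA))
    ... | f , f∈M₀ , f~g = lose (∈-filter⁺ InMA? f∈M₀ (lose g∈MA (sym f~g))) f~g
    MA≤ : length MA ≤ length (filter InMA? M₀)
    MA≤ = matching-∈A⇒length≤ (proj₁ (proj₁ MA-maximal)) (All.tabulate MA-partner)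
    Y₂-partner : ∀ {e} → e ∈ filter Y₂? M⋆ → proj₂ e ∈B filter (∁? InMA?) M₀
    Y₂-partner e∈Y₂ with ∈-filter⁻ Y₂? e∈Y₂
    ... | e∈M⋆ , e∉A₀ , no-partner-in-MA with find (∉A₀⇒∈B₀ (All.lookup (proj₂ M⋆-matching) e∈M⋆) e∉A₀)
    ... | f , f∈M₀ , f~e =
      lose (∈-filter⁺ (∁? InMA?) f∈M₀ (λ f∈A → no-partner-in-MA (lose f∈M₀ (f~e , f∈A)))) f~e
    y₂≤ : y₂ ≤ length (filter (∁? InMA?) M₀)
    y₂≤ = matching-∈B⇒length≤ (AllPairs.filter⁺ Y₂? (proj₁ M⋆-matching)) (All.tabulate Y₂-partner)

  output-bound : length M₀ + length MB ≤ length (output stream M₀)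
  output-bound = length-augment (proj₁ (proj₁ M₀-maximal)) (All.map proj₂ (proj₂ (proj₁ MB-maximal)))

theorem3p1 : ∀ {m n : ℕ} (stream : List (Edge m n)) (M₀ Mstar : List (Edge m n))
    → MaximalMatchingIn (_∈ stream) M₀
    → MaximumMatchingIn (_∈ stream) Mstar
    → 6 * length Mstar ≤ 10 * length (output stream M₀)
theorem3p1 stream M₀ M⋆ M₀-maximal (M⋆-matching , _) =
  weighted-sum M⋆-bound A₀-bound B₀-bound x-bound y₁-bound y₂-bound output-bound
  where open ThreePassBounds stream M₀ M⋆ M₀-maximal M⋆-matching
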